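{- Let $L$ be an oriented link with components $a_1,\dots,a_n$ and $L'$ an oriented link with components $b_1,\dots,b_m$. Let $A$ be the oriented link obtained as the connected sum of $L$ and $L'$ along the components $a_1$ and $b_1$, and $B$ the oriented link obtained as the connected sum of $L$ and $L'$ along $a_2$ and $b_1$ (both connected sums compatible with the orientations). Then $f(A)=f(B)$, where for an oriented link $K$ whose components are labelled $1,\dots,N$, \[ f(K)=\sum_{E\subseteq\{2,\dots,N\}}\gamma^{\sum_{j\in E,\ k\in\{1,\dots,N\}\setminus E}\operatorname{lk}_K(j,k)}\in\mathbb Z[\gamma,\gamma^{ -1}]. \]
   Context: For an oriented link diagram, the sign of a crossing is $+1$ or $-1$ according to the standard right-hand rule; for components $i\ne j$ of an oriented link $K$, the linking number $\operatorname{lk}_K(i,j)$ is the sum of the signs of the crossings between components $i$ and $j$ (as defined in the paper; it is twice the usual linking number). The connected sum of two links along chosen components is formed by cutting an arc of each chosen component (in split position) and joining the free ends consistently with the orientations; the two chosen components become one component of the sum. -}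

module Defs where

open import Data.Nat using (ℕ; zero; suc; _+_)
open import Data.Integer as ℤ using (ℤ; +_; -[1+_]) renaming (_+_ to _+ℤ_)
open import Data.Fin using (Fin; zero; suc; _↑ˡ_; _↑ʳ_; _≟_)
open import Data.Vec using (Vec; []; _∷_; lookup)
open import Data.List using (List; []; _∷_; map; _++_; foldr; allFin)
open import Data.Bool using (Bool; true; false; if_then_else_; _∧_; _∨_; not)
open import Data.Sign using (Sign)
open import Data.Product using (_×_; _,_)
open import Relation.Nullary.Decidable using (⌊_⌋)
open import Relation.Binary.PropositionalEquality using (_≡_)

sumℤ : List ℤ → ℤ
sumℤ = foldr _+ℤ_ (+ 0)

ΣFin : (k : ℕ) → (Fin k → ℤ) → ℤ
ΣFin k g = sumℤ (map g (allFin k))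

-- A diagram with `c` components (labelled by Fin c) is given by its list of
-- crossings; each crossing records the component of its over-strand, the
-- component of its under-strand, and its sign (right-hand rule).

record Crossing (c : ℕ) : Set where
  constructor crossing
  field
    over  : Fin c
    under : Fin c
    sign  : Sign
open Crossing public

Diagram : ℕ → Set
Diagram c = List (Crossing c)

signℤ : Sign → ℤ
signℤ Sign.+ = + 1
signℤ Sign.- = -[1+ 0 ]

between : ∀ {c} → Crossing c → Fin c → Fin c → Bool
between x i j =
  (⌊ over x ≟ i ⌋ ∧ ⌊ under x ≟ j ⌋) ∨ (⌊ over x ≟ j ⌋ ∧ ⌊ under x ≟ i ⌋)

lk : ∀ {c} → Diagram c → Fin c → Fin c → ℤ
lk K i j = sumℤ (map (λ x → if between x i j then signℤ (sign x) else + 0) K)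

relabel : ∀ {c d} → (Fin c → Fin d) → Diagram c → Diagram d
relabel ι = map (λ x → crossing (ι (over x)) (ι (under x)) (sign x))

-- L has components a₁,…,a_{n+2} (Fin (2+n)), L' has components
-- b₁,…,b_{m+1} (Fin (1+m)).  `connectedSum L L' i` joins component a_{i+1}
-- of L with b₁ of L'.  Components of the result (Fin (2+n+m)):
-- index k < 2+n is a_{k+1} (with a_{i+1} being the merged component
-- a_{i+1} # b₁), index 2+n+j is b_{j+2}.
embedL' : ∀ {n m} → Fin (suc (suc n)) → Fin (suc m) → Fin (suc (suc n) + m)
embedL' {n} {m} i zero    = i ↑ˡ m
embedL' {n} {m} i (suc j) = suc (suc n) ↑ʳ j

connectedSum : ∀ {n m} → Diagram (suc (suc n)) → Diagram (suc m) →
               Fin (suc (suc n)) → Diagram (suc (suc n) + m)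
connectedSum {n} {m} L L' i = relabel (_↑ˡ m) L ++ relabel (embedL' i) L'

-- Laurent polynomials in ℤ[γ, γ⁻¹]: finite formal sums of terms
-- (coefficient , exponent); equality is equality of all coefficients.

LPoly : Set
LPoly = List (ℤ × ℤ)

coeff : LPoly → ℤ → ℤ
coeff p d = sumℤ (map (λ { (a , e) → if ⌊ e ℤ.≟ d ⌋ then a else + 0 }) p)

_≈ₗ_ : LPoly → LPoly → Set
p ≈ₗ q = ∀ d → coeff p d ≡ coeff q d

γ^ : ℤ → LPoly
γ^ e = (+ 1 , e) ∷ []

-- The invariant f.  Components 1,…,N are Fin N with N = suc N';
-- component "1" is index zero.  Subsets E ⊆ {2,…,N} are Vec Bool N'
-- (membership of suc k is the k-th entry).

allSubsets : (k : ℕ) → List (Vec Bool k)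
allSubsets zero    = [] ∷ []
allSubsets (suc k) = map (true ∷_) (allSubsets k) ++ map (false ∷_) (allSubsets k)

memb : ∀ {N'} → Vec Bool N' → Fin (suc N') → Bool
memb E zero    = false
memb E (suc k) = lookup E k

cutExp : ∀ {N'} → Diagram (suc N') → Vec Bool N' → ℤ
cutExp {N'} K E =
  ΣFin (suc N') λ j → ΣFin (suc N') λ k →
    if memb E j ∧ not (memb E k) then lk K j k else + 0

f : ∀ {N'} → Diagram (suc N') → LPoly
f {N'} K = foldr _++_ [] (map (λ E → γ^ (cutExp K E)) (allSubsets N'))

module Submission where

-- The exponent Σ_{j ∈ E, k ∉ E} lk(j,k) is a cut count: the signed number of crossings whose two
-- strands lie on opposite sides of the partition (E, complement of E). For a connected sum it splits
-- into the cut count of L plus that of L', where b₁ sits on the side of the component it was merged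
-- with. Split E into its L-part E₁ and its L'-part E₂. In A, b₁ is on the side of a₁, which is never
-- in E; in B, it is on the side of a₂. If a₂ ∉ E the exponents agree; if a₂ ∈ E, the bijection
-- E₂ ↦ complement of E₂ moves every component of L' to the other side, which preserves the cut count
-- of L'. So both sums run over the same multiset of exponents.

open import Defs
open import Data.Nat using (ℕ; suc)
open import Data.Fin using (Fin; zero; suc)

open import Data.Nat using (zero; _+_)
open import Data.Fin using (_↑ˡ_; _≟_)
open import Data.Integer using (ℤ; +_) renaming (_+_ to _+ℤ_)
open import Data.Integer.Properties using (+-identityˡ; +-identityʳ; +-assoc; +-comm; +-commutativeSemigroup)
open import Algebra.Properties.CommutativeSemigroup +-commutativeSemigroup using (interchange)
open import Data.Vec using (Vec; _∷_; lookup) renaming (_++_ to _++ᵥ_; map to mapᵥ)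
open import Data.Vec.Properties using (lookup-++ˡ; lookup-++ʳ; lookup-map)
open import Data.List using (List; []; _∷_; map; _++_; foldr; allFin)
open import Data.List.Properties using (map-tabulate)
open import Data.Bool using (Bool; true; false; if_then_else_; _∧_; _∨_; _xor_; not; T)
open import Data.Bool.Properties using (∧-comm; ∧-inverseʳ; not-involutive)
open import Data.Empty using (⊥-elim)
open import Relation.Nullary using (yes; no)
open import Relation.Nullary.Decidable using (⌊_⌋; isYes≗does)
open import Relation.Binary.PropositionalEquality
open import Function using (_∘_)
open ≡-Reasoning

private
  variable
    A B : Set
    c : ℕ

when : Bool → ℤ → ℤ
when b z = if b then z else + 0

∑ : List A → (A → ℤ) → ℤ
∑ xs g = sumℤ (map g xs)

infix 5 ∑
syntax ∑ xs (λ x → g) = ∑[ x ∈ xs ] g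

∑-cong : (xs : List A) {g h : A → ℤ} → (∀ x → g x ≡ h x) → ∑ xs g ≡ ∑ xs h
∑-cong []       g≗h = refl
∑-cong (x ∷ xs) g≗h = cong₂ _+ℤ_ (g≗h x) (∑-cong xs g≗h)

∑-0 : (xs : List A) → ∑[ x ∈ xs ] + 0 ≡ + 0
∑-0 []       = refl
∑-0 (x ∷ xs) = trans (+-identityˡ _) (∑-0 xs)

∑-++ : (xs ys : List A) (g : A → ℤ) → ∑ (xs ++ ys) g ≡ ∑ xs g +ℤ ∑ ys g
∑-++ []       ys g = sym (+-identityˡ _)
∑-++ (x ∷ xs) ys g = trans (cong (g x +ℤ_) (∑-++ xs ys g)) (sym (+-assoc (g x) _ _))

∑-map : (h : A → B) (xs : List A) (g : B → ℤ) → ∑ (map h xs) g ≡ ∑ xs (g ∘ h)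
∑-map h []       g = refl
∑-map h (x ∷ xs) g = cong (g (h x) +ℤ_) (∑-map h xs g)

∑-distrib-+ : (xs : List A) (g h : A → ℤ) → ∑[ x ∈ xs ] (g x +ℤ h x) ≡ ∑ xs g +ℤ ∑ xs h
∑-distrib-+ []       g h = refl
∑-distrib-+ (x ∷ xs) g h =
  trans (cong ((g x +ℤ h x) +ℤ_) (∑-distrib-+ xs g h)) (interchange (g x) (h x) (∑ xs g) (∑ xs h))

∑-comm : (xs : List A) (ys : List B) (g : A → B → ℤ) →
  ∑[ x ∈ xs ] ∑ ys (g x) ≡ ∑[ y ∈ ys ] ∑[ x ∈ xs ] g x y
∑-comm []       ys g = sym (∑-0 ys)
∑-comm (x ∷ xs) ys g = begin
  ∑ ys (g x) +ℤ (∑[ x ∈ xs ] ∑ ys (g x))        ≡⟨ cong (∑ ys (g x) +ℤ_) (∑-comm xs ys g) ⟩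
  ∑ ys (g x) +ℤ (∑[ y ∈ ys ] ∑[ x ∈ xs ] g x y)  ≡⟨ sym (∑-distrib-+ ys (g x) _) ⟩
  ∑[ y ∈ ys ] (g x y +ℤ (∑[ x ∈ xs ] g x y))      ∎

when-distrib-∑ : (b : Bool) (xs : List A) (g : A → ℤ) → when b (∑ xs g) ≡ ∑[ x ∈ xs ] when b (g x)
when-distrib-∑ true  xs g = refl
when-distrib-∑ false xs g = sym (∑-0 xs)

∑-allFin-suc : (g : Fin (suc c) → ℤ) → ∑ (allFin (suc c)) g ≡ g zero +ℤ ∑ (allFin c) (g ∘ suc)
∑-allFin-suc {c} g = cong (g zero +ℤ_) (
  trans (cong (λ is → ∑ is g) (sym (map-tabulate (λ i → i) suc))) (∑-map suc (allFin c) g))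

∑-allFin-δ : (a : Fin c) (v : Fin c → ℤ) → ∑[ k ∈ allFin c ] when ⌊ a ≟ k ⌋ (v k) ≡ v a
∑-allFin-δ {suc c} zero v = begin
  ∑[ k ∈ allFin (suc c) ] when ⌊ zero ≟ k ⌋ (v k) ≡⟨ ∑-allFin-suc (λ k → when ⌊ zero ≟ k ⌋ (v k)) ⟩
  v zero +ℤ (∑[ k ∈ allFin c ] + 0)             ≡⟨ cong (v zero +ℤ_) (∑-0 (allFin c)) ⟩
  v zero +ℤ + 0                                  ≡⟨ +-identityʳ (v zero) ⟩
  v zero                                         ∎
∑-allFin-δ {suc c} (suc a) v = begin
  ∑[ k ∈ allFin (suc c) ] when ⌊ suc a ≟ k ⌋ (v k)
    ≡⟨ ∑-allFin-suc (λ k → when ⌊ suc a ≟ k ⌋ (v k)) ⟩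
  + 0 +ℤ (∑[ k ∈ allFin c ] when ⌊ suc a ≟ suc k ⌋ (v (suc k)))
    ≡⟨ +-identityˡ _ ⟩
  ∑[ k ∈ allFin c ] when ⌊ suc a ≟ suc k ⌋ (v (suc k))
    ≡⟨ ∑-cong (allFin c) (λ k → cong (λ b → when b (v (suc k))) (⌊suc≟suc⌋ a k)) ⟩
  ∑[ k ∈ allFin c ] when ⌊ a ≟ k ⌋ (v (suc k))
    ≡⟨ ∑-allFin-δ a (v ∘ suc) ⟩
  v (suc a) ∎
  where
  ⌊suc≟suc⌋ : (a k : Fin c) → ⌊ suc a ≟ suc k ⌋ ≡ ⌊ a ≟ k ⌋
  ⌊suc≟suc⌋ a k = trans (isYes≗does (suc a ≟ suc k)) (sym (isYes≗does (a ≟ k)))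

when-∧ : (a b : Bool) (z : ℤ) → when (a ∧ b) z ≡ when a (when b z)
when-∧ true  b z = refl
when-∧ false b z = refl

∑∑-allFin-δ : (a b : Fin c) (v : Fin c → Fin c → ℤ) →
  ∑[ j ∈ allFin c ] ∑[ k ∈ allFin c ] when (⌊ a ≟ j ⌋ ∧ ⌊ b ≟ k ⌋) (v j k) ≡ v a b
∑∑-allFin-δ {c} a b v = begin
  ∑[ j ∈ allFin c ] ∑[ k ∈ allFin c ] when (⌊ a ≟ j ⌋ ∧ ⌊ b ≟ k ⌋) (v j k)
    ≡⟨ ∑-cong (allFin c) (λ j → ∑-cong (allFin c) (λ k → when-∧ ⌊ a ≟ j ⌋ _ _)) ⟩
  ∑[ j ∈ allFin c ] ∑[ k ∈ allFin c ] when ⌊ a ≟ j ⌋ (when ⌊ b ≟ k ⌋ (v j k))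
    ≡⟨ ∑-cong (allFin c) (λ j → sym (when-distrib-∑ ⌊ a ≟ j ⌋ (allFin c) _)) ⟩
  ∑[ j ∈ allFin c ] when ⌊ a ≟ j ⌋ (∑[ k ∈ allFin c ] when ⌊ b ≟ k ⌋ (v j k))
    ≡⟨ ∑-allFin-δ a _ ⟩
  ∑[ k ∈ allFin c ] when ⌊ b ≟ k ⌋ (v a k)
    ≡⟨ ∑-allFin-δ b (v a) ⟩
  v a b ∎

when-∨ : (c p q : Bool) (z : ℤ) → (T p → T q → c ≡ false) →
  when c (when (p ∨ q) z) ≡ when p (when c z) +ℤ when q (when c z)
when-∨ c true  true  z p⇒q⇒¬c rewrite p⇒q⇒¬c _ _ = refl
when-∨ c true  false z _ = sym (+-identityʳ _)
when-∨ c false true  z _ = sym (+-identityˡ _)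
when-∨ true  false false z _ = refl
when-∨ false false false z _ = refl

when-xor : (a b : Bool) (z : ℤ) → when (a ∧ not b) z +ℤ when (b ∧ not a) z ≡ when (a xor b) z
when-xor true  true  z = refl
when-xor true  false z = +-identityʳ z
when-xor false true  z = +-identityˡ z
when-xor false false z = refl

cut : Diagram c → (Fin c → Bool) → ℤ
cut K χ = ∑[ x ∈ K ] when (χ (over x) xor χ (under x)) (signℤ (sign x))

∑∑-separated-between : (χ : Fin c → Bool) (x : Crossing c) (z : ℤ) →
  ∑[ j ∈ allFin c ] ∑[ k ∈ allFin c ] when (χ j ∧ not (χ k)) (when (between x j k) z)
  ≡ when (χ (over x) xor χ (under x)) z
∑∑-separated-between {c} χ x z = begin
  ∑[ j ∈ js ] ∑[ k ∈ js ] when (χ j ∧ not (χ k)) (when (between x j k) z)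
    ≡⟨ ∑-cong js (λ j → ∑-cong js (λ k → when-∨ _ (o→ j ∧ u→ k) (o→ k ∧ u→ j) z (diagonal-unseparated j k))) ⟩
  ∑[ j ∈ js ] ∑[ k ∈ js ] (when (o→ j ∧ u→ k) (separates j k) +ℤ when (o→ k ∧ u→ j) (separates j k))
    ≡⟨ ∑-cong js (λ j → ∑-distrib-+ js _ _) ⟩
  ∑[ j ∈ js ] ((∑[ k ∈ js ] when (o→ j ∧ u→ k) (separates j k))
                +ℤ (∑[ k ∈ js ] when (o→ k ∧ u→ j) (separates j k)))
    ≡⟨ ∑-distrib-+ js _ _ ⟩
  (∑[ j ∈ js ] ∑[ k ∈ js ] when (o→ j ∧ u→ k) (separates j k))
    +ℤ (∑[ j ∈ js ] ∑[ k ∈ js ] when (o→ k ∧ u→ j) (separates j k))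
    ≡⟨ cong ((∑[ j ∈ js ] ∑[ k ∈ js ] when (o→ j ∧ u→ k) (separates j k)) +ℤ_)
         (∑-cong js (λ j → ∑-cong js (λ k → cong (λ b → when b (separates j k)) (∧-comm (o→ k) (u→ j))))) ⟩
  (∑[ j ∈ js ] ∑[ k ∈ js ] when (o→ j ∧ u→ k) (separates j k))
    +ℤ (∑[ j ∈ js ] ∑[ k ∈ js ] when (u→ j ∧ o→ k) (separates j k))
    ≡⟨ cong₂ _+ℤ_ (∑∑-allFin-δ (over x) (under x) separates) (∑∑-allFin-δ (under x) (over x) separates) ⟩
  separates (over x) (under x) +ℤ separates (under x) (over x)
    ≡⟨ when-xor (χ (over x)) (χ (under x)) z ⟩
  when (χ (over x) xor χ (under x)) z ∎
  where
  js = allFin c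
  o→ u→ : Fin c → Bool
  o→ j = ⌊ over x ≟ j ⌋
  u→ j = ⌊ under x ≟ j ⌋
  separates : Fin c → Fin c → ℤ
  separates j k = when (χ j ∧ not (χ k)) z
  -- both disjuncts of `between x j k` hold only for a self-crossing with j ≡ k, and χ never separates j from j
  diagonal-unseparated : (j k : Fin c) → T (o→ j ∧ u→ k) → T (o→ k ∧ u→ j) → χ j ∧ not (χ k) ≡ false
  diagonal-unseparated j k oj ok with over x ≟ j | over x ≟ k
  ... | yes refl | yes refl = ∧-inverseʳ (χ (over x))
  ... | no _     | _        = ⊥-elim oj
  ... | yes _    | no _     = ⊥-elim ok

∑∑-lk≡cut : (K : Diagram c) (χ : Fin c → Bool) →
  ∑[ j ∈ allFin c ] ∑[ k ∈ allFin c ] when (χ j ∧ not (χ k)) (lk K j k) ≡ cut K χ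
∑∑-lk≡cut {c} K χ = begin
  ∑[ j ∈ js ] ∑[ k ∈ js ] when (χ j ∧ not (χ k)) (∑[ x ∈ K ] when (between x j k) (s x))
    ≡⟨ ∑-cong js (λ j → ∑-cong js (λ k → when-distrib-∑ (χ j ∧ not (χ k)) K _)) ⟩
  ∑[ j ∈ js ] ∑[ k ∈ js ] ∑[ x ∈ K ] term j k x
    ≡⟨ ∑-cong js (λ j → ∑-comm js K (term j)) ⟩
  ∑[ j ∈ js ] ∑[ x ∈ K ] ∑[ k ∈ js ] term j k x
    ≡⟨ ∑-comm js K _ ⟩
  ∑[ x ∈ K ] ∑[ j ∈ js ] ∑[ k ∈ js ] term j k x
    ≡⟨ ∑-cong K (λ x → ∑∑-separated-between χ x (s x)) ⟩
  cut K χ ∎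
  where
  js = allFin c
  s : Crossing c → ℤ
  s x = signℤ (sign x)
  term : Fin c → Fin c → Crossing c → ℤ
  term j k x = when (χ j ∧ not (χ k)) (when (between x j k) (s x))

cut-cong : (K : Diagram c) {χ χ' : Fin c → Bool} → (∀ i → χ i ≡ χ' i) → cut K χ ≡ cut K χ'
cut-cong K χ≗χ' =
  ∑-cong K (λ x → cong (λ b → when b (signℤ (sign x))) (cong₂ _xor_ (χ≗χ' (over x)) (χ≗χ' (under x))))

cut-not : (K : Diagram c) (χ : Fin c → Bool) → cut K (not ∘ χ) ≡ cut K χ
cut-not K χ = ∑-cong K (λ x → cong (λ b → when b (signℤ (sign x))) (not-xor-not (χ (over x)) (χ (under x))))
  where
  not-xor-not : (a b : Bool) → not a xor not b ≡ a xor b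
  not-xor-not true  b = refl
  not-xor-not false b = not-involutive b

cut-connectedSum : ∀ {n m} (L : Diagram (suc (suc n))) (L' : Diagram (suc m)) (i : Fin (suc (suc n)))
  (χ : Fin (suc (suc n) + m) → Bool) →
  cut (connectedSum L L' i) χ ≡ cut L (χ ∘ (_↑ˡ m)) +ℤ cut L' (χ ∘ embedL' i)
cut-connectedSum {m = m} L L' i χ =
  trans (∑-++ (relabel (_↑ˡ m) L) (relabel (embedL' i) L') _)
        (cong₂ _+ℤ_ (∑-map _ L _) (∑-map _ L' _))

memb-++-↑ˡ : ∀ {n m} (E₁ : Vec Bool n) (E₂ : Vec Bool m) (x : Fin (suc n)) →
  memb (E₁ ++ᵥ E₂) (x ↑ˡ m) ≡ memb E₁ x
memb-++-↑ˡ E₁ E₂ zero    = refl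
memb-++-↑ˡ E₁ E₂ (suc x) = lookup-++ˡ E₁ E₂ x

memb-++-embedL' : ∀ {n m} (E₁ : Vec Bool (suc n)) (E₂ : Vec Bool m) (i : Fin (suc (suc n))) (y : Fin (suc m)) →
  memb (E₁ ++ᵥ E₂) (embedL' i y) ≡ lookup (memb E₁ i ∷ E₂) y
memb-++-embedL' E₁ E₂ i zero    = memb-++-↑ˡ E₁ E₂ i
memb-++-embedL' E₁ E₂ i (suc y) = lookup-++ʳ E₁ E₂ y

cutExp-connectedSum : ∀ {n m} (L : Diagram (suc (suc n))) (L' : Diagram (suc m)) (i : Fin (suc (suc n)))
  (E₁ : Vec Bool (suc n)) (E₂ : Vec Bool m) →
  cutExp (connectedSum L L' i) (E₁ ++ᵥ E₂) ≡ cut L (memb E₁) +ℤ cut L' (lookup (memb E₁ i ∷ E₂))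
cutExp-connectedSum L L' i E₁ E₂ = begin
  cutExp (connectedSum L L' i) (E₁ ++ᵥ E₂)
    ≡⟨ ∑∑-lk≡cut (connectedSum L L' i) (memb (E₁ ++ᵥ E₂)) ⟩
  cut (connectedSum L L' i) (memb (E₁ ++ᵥ E₂))
    ≡⟨ cut-connectedSum L L' i (memb (E₁ ++ᵥ E₂)) ⟩
  cut L (memb (E₁ ++ᵥ E₂) ∘ (_↑ˡ _)) +ℤ cut L' (memb (E₁ ++ᵥ E₂) ∘ embedL' i)
    ≡⟨ cong₂ _+ℤ_ (cut-cong L (memb-++-↑ˡ E₁ E₂)) (cut-cong L' (memb-++-embedL' E₁ E₂ i)) ⟩
  cut L (memb E₁) +ℤ cut L' (lookup (memb E₁ i ∷ E₂)) ∎

∑-allSubsets-suc : (k : ℕ) (g : Vec Bool (suc k) → ℤ) →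
  ∑ (allSubsets (suc k)) g ≡ (∑[ E ∈ allSubsets k ] g (true ∷ E)) +ℤ (∑[ E ∈ allSubsets k ] g (false ∷ E))
∑-allSubsets-suc k g =
  trans (∑-++ (map (true ∷_) (allSubsets k)) (map (false ∷_) (allSubsets k)) g)
        (cong₂ _+ℤ_ (∑-map (true ∷_) (allSubsets k) g) (∑-map (false ∷_) (allSubsets k) g))

∑-allSubsets-++ : (k l : ℕ) (g : Vec Bool (k + l) → ℤ) →
  ∑ (allSubsets (k + l)) g ≡ ∑[ E₁ ∈ allSubsets k ] ∑[ E₂ ∈ allSubsets l ] g (E₁ ++ᵥ E₂)
∑-allSubsets-++ zero    l g = sym (+-identityʳ _)
∑-allSubsets-++ (suc k) l g = begin
  ∑ (allSubsets (suc k + l)) g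
    ≡⟨ ∑-allSubsets-suc (k + l) g ⟩
  (∑[ E ∈ allSubsets (k + l) ] g (true ∷ E)) +ℤ (∑[ E ∈ allSubsets (k + l) ] g (false ∷ E))
    ≡⟨ cong₂ _+ℤ_ (∑-allSubsets-++ k l (g ∘ (true ∷_))) (∑-allSubsets-++ k l (g ∘ (false ∷_))) ⟩
  (∑[ E₁ ∈ allSubsets k ] ∑[ E₂ ∈ allSubsets l ] g (true ∷ E₁ ++ᵥ E₂))
    +ℤ (∑[ E₁ ∈ allSubsets k ] ∑[ E₂ ∈ allSubsets l ] g (false ∷ E₁ ++ᵥ E₂))
    ≡⟨ sym (∑-allSubsets-suc k _) ⟩
  ∑[ E₁ ∈ allSubsets (suc k) ] ∑[ E₂ ∈ allSubsets l ] g (E₁ ++ᵥ E₂) ∎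

∑-allSubsets-complement : (k : ℕ) (g : Vec Bool k → ℤ) → ∑[ E ∈ allSubsets k ] g (mapᵥ not E) ≡ ∑ (allSubsets k) g
∑-allSubsets-complement zero    g = refl
∑-allSubsets-complement (suc k) g = begin
  ∑[ E ∈ allSubsets (suc k) ] g (mapᵥ not E)
    ≡⟨ ∑-allSubsets-suc k (g ∘ mapᵥ not) ⟩
  (∑[ E ∈ allSubsets k ] g (false ∷ mapᵥ not E)) +ℤ (∑[ E ∈ allSubsets k ] g (true ∷ mapᵥ not E))
    ≡⟨ cong₂ _+ℤ_ (∑-allSubsets-complement k (g ∘ (false ∷_))) (∑-allSubsets-complement k (g ∘ (true ∷_))) ⟩
  (∑[ E ∈ allSubsets k ] g (false ∷ E)) +ℤ (∑[ E ∈ allSubsets k ] g (true ∷ E))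
    ≡⟨ +-comm (∑[ E ∈ allSubsets k ] g (false ∷ E)) _ ⟩
  (∑[ E ∈ allSubsets k ] g (true ∷ E)) +ℤ (∑[ E ∈ allSubsets k ] g (false ∷ E))
    ≡⟨ sym (∑-allSubsets-suc k g) ⟩
  ∑ (allSubsets (suc k)) g ∎

∑-allSubsets-head-irrelevant : (k : ℕ) (g : Vec Bool (suc k) → ℤ) → (∀ E → g (mapᵥ not E) ≡ g E) →
  (b : Bool) → ∑[ E ∈ allSubsets k ] g (false ∷ E) ≡ ∑[ E ∈ allSubsets k ] g (b ∷ E)
∑-allSubsets-head-irrelevant k g g∘not≗g false = refl
∑-allSubsets-head-irrelevant k g g∘not≗g true  =
  trans (∑-cong (allSubsets k) (λ E → sym (g∘not≗g (false ∷ E))))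
        (∑-allSubsets-complement k (g ∘ (true ∷_)))

coeff-++ : (p q : LPoly) (d : ℤ) → coeff (p ++ q) d ≡ coeff p d +ℤ coeff q d
coeff-++ p q d = ∑-++ p q _

coeff-concat : (ps : List LPoly) (d : ℤ) → coeff (foldr _++_ [] ps) d ≡ ∑[ p ∈ ps ] coeff p d
coeff-concat []       d = refl
coeff-concat (p ∷ ps) d = trans (coeff-++ p (foldr _++_ [] ps) d) (cong (coeff p d +ℤ_) (coeff-concat ps d))

coeff-f : ∀ {N'} (K : Diagram (suc N')) (d : ℤ) → coeff (f K) d ≡ ∑[ E ∈ allSubsets N' ] coeff (γ^ (cutExp K E)) d
coeff-f {N'} K d =
  trans (coeff-concat (map (λ E → γ^ (cutExp K E)) (allSubsets N')) d) (∑-map _ (allSubsets N') (λ p → coeff p d))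

∑-cutExp-connectedSum-fibre : ∀ {n m} (L : Diagram (suc (suc n))) (L' : Diagram (suc m)) (g : ℤ → ℤ)
  (E₁ : Vec Bool (suc n)) →
  ∑[ E₂ ∈ allSubsets m ] g (cutExp (connectedSum L L' zero) (E₁ ++ᵥ E₂))
  ≡ ∑[ E₂ ∈ allSubsets m ] g (cutExp (connectedSum L L' (suc zero)) (E₁ ++ᵥ E₂))
∑-cutExp-connectedSum-fibre {m = m} L L' g E₁ = begin
  ∑[ E₂ ∈ allSubsets m ] g (cutExp (connectedSum L L' zero) (E₁ ++ᵥ E₂))
    ≡⟨ ∑-cong (allSubsets m) (λ E₂ → cong g (cutExp-connectedSum L L' zero E₁ E₂)) ⟩
  ∑[ E₂ ∈ allSubsets m ] term (false ∷ E₂)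
    ≡⟨ ∑-allSubsets-head-irrelevant m term term-complement (memb E₁ (suc zero)) ⟩
  ∑[ E₂ ∈ allSubsets m ] term (memb E₁ (suc zero) ∷ E₂)
    ≡⟨ ∑-cong (allSubsets m) (λ E₂ → cong g (sym (cutExp-connectedSum L L' (suc zero) E₁ E₂))) ⟩
  ∑[ E₂ ∈ allSubsets m ] g (cutExp (connectedSum L L' (suc zero)) (E₁ ++ᵥ E₂)) ∎
  where
  term : Vec Bool (suc m) → ℤ
  term v = g (cut L (memb E₁) +ℤ cut L' (lookup v))
  term-complement : ∀ v → term (mapᵥ not v) ≡ term v
  term-complement v = cong (λ t → g (cut L (memb E₁) +ℤ t))
    (trans (cut-cong L' (λ y → lookup-map y not v)) (cut-not L' (lookup v)))

∑-cutExp-connectedSum : ∀ {n m} (L : Diagram (suc (suc n))) (L' : Diagram (suc m)) (g : ℤ → ℤ) →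
  ∑[ E ∈ allSubsets (suc n + m) ] g (cutExp (connectedSum L L' zero) E)
  ≡ ∑[ E ∈ allSubsets (suc n + m) ] g (cutExp (connectedSum L L' (suc zero)) E)
∑-cutExp-connectedSum {n} {m} L L' g = begin
  ∑[ E ∈ allSubsets (suc n + m) ] g (cutExp (connectedSum L L' zero) E)
    ≡⟨ ∑-allSubsets-++ (suc n) m _ ⟩
  ∑[ E₁ ∈ allSubsets (suc n) ] ∑[ E₂ ∈ allSubsets m ] g (cutExp (connectedSum L L' zero) (E₁ ++ᵥ E₂))
    ≡⟨ ∑-cong (allSubsets (suc n)) (∑-cutExp-connectedSum-fibre L L' g) ⟩
  ∑[ E₁ ∈ allSubsets (suc n) ] ∑[ E₂ ∈ allSubsets m ] g (cutExp (connectedSum L L' (suc zero)) (E₁ ++ᵥ E₂))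
    ≡⟨ sym (∑-allSubsets-++ (suc n) m _) ⟩
  ∑[ E ∈ allSubsets (suc n + m) ] g (cutExp (connectedSum L L' (suc zero)) E) ∎

lemma6p7 : (n m : ℕ) (L : Diagram (suc (suc n))) (L' : Diagram (suc m)) →
    f (connectedSum L L' zero) ≈ₗ f (connectedSum L L' (suc zero))
lemma6p7 n m L L' d = begin
  coeff (f (connectedSum L L' zero)) d
    ≡⟨ coeff-f (connectedSum L L' zero) d ⟩
  ∑[ E ∈ allSubsets (suc n + m) ] coeff (γ^ (cutExp (connectedSum L L' zero) E)) d
    ≡⟨ ∑-cutExp-connectedSum L L' (λ e → coeff (γ^ e) d) ⟩
  ∑[ E ∈ allSubsets (suc n + m) ] coeff (γ^ (cutExp (connectedSum L L' (suc zero)) E)) d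
    ≡⟨ sym (coeff-f (connectedSum L L' (suc zero)) d) ⟩
  coeff (f (connectedSum L L' (suc zero))) d ∎
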